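{- In the satisfaction system of preference statements with hierarchical models, let $\alpha,\beta\in\underline{V}$. Then: (1) $\alpha\geq\beta$ is a tautology iff $\bigoplus_{y\in Y}\alpha(y)\geq\bigoplus_{y\in Y}\beta(y)$ for all nonempty $Y\subseteq V$, iff $\beta>\alpha$ is a contradiction. (2) $\alpha>\beta$ is a tautology iff $\bigoplus_{y\in Y}\alpha(y)>\bigoplus_{y\in Y}\beta(y)$ for all nonempty $Y\subseteq V$, iff $\beta\geq\alpha$ is a contradiction.
   Context: Let $V$ be a finite set of variables; each $v\in V$ has a finite domain $\underline{v}$ with more than one element; alternatives are elements $\alpha\in\underline{V}=\prod_{v\in V}\underline{v}$, with $\alpha(v)$ the value of $v$. Let $\oplus$ be a commutative, associative operator combining values of any nonempty set of variables, and assume a total order $\geq$ on the domains and on $\oplus$-combinations of values. A hierarchical model is a non-empty sequence $\pi=(Y_1,\ldots,Y_k)$ of non-empty (not necessarily disjoint) subsets of $V$. $\pi\models\alpha\geq\beta$ iff either $\bigoplus_{y\in Y_i}\alpha(y)=\bigoplus_{y\in Y_i}\beta(y)$ for all $i$, or there is $i$ with $\bigoplus_{y\in Y_i}\alpha(y)>\bigoplus_{y\in Y_i}\beta(y)$ and equality for all $j<i$; $\pi\models\alpha>\beta$ iff the second of these conditions holds. A statement is a tautology if every hierarchical model satisfies it and a contradiction if no hierarchical model satisfies it. -}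

module Defs where

open import Data.Nat using (ℕ; zero; suc; _≤_)
open import Data.Fin as Fin using (Fin; zero; suc)
open import Data.Fin.Subset using (Subset; Nonempty; inside; outside; _∈_)
open import Data.Vec using ([]; _∷_; here; there)
open import Data.Maybe using (Maybe; just; nothing)
open import Data.Product using (Σ; ∃; _×_; _,_; proj₁)
open import Data.Sum using (_⊎_)
open import Data.Empty using (⊥-elim)
open import Function using (_∘_)
open import Function.Definitions using (Injective)
open import Relation.Binary.PropositionalEquality using (_≡_; refl)
open import Relation.Binary.Structures using (IsStrictTotalOrder)
open import Relation.Nullary using (¬_)
import Algebra.Definitions as AD

-- The setting of the paper.
--   * V = Fin n  (a finite set of variables);
--   * the domain of variable v is Fin (dsize v), a finite set with more
--     than one element (2 ≤ dsize v);
--   * all domain values and all ⊕-combinations of values live in one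
--     carrier D, with a commutative associative ⊕ and a (strict) total
--     order _<_ on D; the non-strict order ≥ is "> or ≡".
--   * val v : Fin (dsize v) → D interprets the values of v in D
--     (injective, so that the order on D is a total order on each domain).
record Setting : Set₁ where
  field
    n        : ℕ
    dsize    : Fin n → ℕ
    dsize≥2  : ∀ v → 2 ≤ dsize v
    D        : Set
    _⊕_      : D → D → D
    ⊕-comm   : AD.Commutative _≡_ _⊕_
    ⊕-assoc  : AD.Associative _≡_ _⊕_
    _<_      : D → D → Set
    <-isSTO  : IsStrictTotalOrder _≡_ _<_
    val      : (v : Fin n) → Fin (dsize v) → D
    val-inj  : ∀ v → Injective _≡_ _≡_ (val v)

  _>_ : D → D → Set
  a > b = b < a

  _≥_ : D → D → Set
  a ≥ b = (a > b) ⊎ (a ≡ b)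

  Alt : Set
  Alt = (v : Fin n) → Fin (dsize v)

foldSub : {D : Set} → (D → D → D) → ∀ {m} → Subset m → (Fin m → D) → Maybe D
foldSub _⊕_ []            f = nothing
foldSub _⊕_ (outside ∷ p) f = foldSub _⊕_ p (f ∘ suc)
foldSub _⊕_ (inside  ∷ p) f with foldSub _⊕_ p (f ∘ suc)
... | nothing = just (f zero)
... | just x  = just (f zero ⊕ x)

foldSub-nonempty : {D : Set} (_⊕_ : D → D → D) → ∀ {m} (p : Subset m) (f : Fin m → D) →
                   Nonempty p → Σ D λ x → foldSub _⊕_ p f ≡ just x
foldSub-nonempty _⊕_ (outside ∷ p) f (zero , ())
foldSub-nonempty _⊕_ (outside ∷ p) f (suc i , there i∈) =
  foldSub-nonempty _⊕_ p (f ∘ suc) (i , i∈)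
foldSub-nonempty _⊕_ (inside ∷ p) f ne with foldSub _⊕_ p (f ∘ suc)
... | nothing = f zero , refl
... | just x  = f zero ⊕ x , refl

⨁ : {D : Set} → (D → D → D) → ∀ {m} (Y : Subset m) → Nonempty Y → (Fin m → D) → D
⨁ _⊕_ Y ne f = proj₁ (foldSub-nonempty _⊕_ Y f ne)

module _ (S : Setting) where
  open Setting S

  comb : (Y : Subset n) → Nonempty Y → Alt → D
  comb Y ne α = ⨁ _⊕_ Y ne (λ y → val y (α y))

  record HModel : Set where
    field
      len    : ℕ
      Y      : Fin (suc len) → Subset n
      Y-ne   : ∀ i → Nonempty (Y i)

  module _ (π : HModel) where
    open HModel π
    C : Alt → Fin (suc len) → D
    C α i = comb (Y i) (Y-ne i) α

    _⊨_≻_ : Alt → Alt → Set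
    _⊨_≻_ α β = ∃ λ i → (C α i > C β i) × (∀ j → j Fin.< i → C α j ≡ C β j)

    _⊨_≽_ : Alt → Alt → Set
    _⊨_≽_ α β = (∀ i → C α i ≡ C β i) ⊎ _⊨_≻_ α β

  Taut≥ Taut> Contr≥ Contr> : Alt → Alt → Set
  Taut≥  α β = ∀ π → _⊨_≽_ π α β
  Taut>  α β = ∀ π → _⊨_≻_ π α β
  Contr≥ α β = ∀ π → ¬ _⊨_≽_ π α β
  Contr> α β = ∀ π → ¬ _⊨_≻_ π α β

-- A one-level model (Y) compares α and β by the single value ⊕_{y∈Y}, so a
-- tautology must hold for every nonempty Y separately.  Conversely, if the
-- comparison holds for every Y, it holds at every level of any model, and the
-- lexicographic comparison is settled at the first strict level.  For the
-- contradiction forms: lexicographically α ≽ β excludes β ≻ α, and if the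
-- comparison fails at some Y, trichotomy makes the one-level model (Y) satisfy
-- the opposite statement.
module Submission where

open import Defs
open import Data.Fin.Subset using (Subset; Nonempty)
open import Data.Product using (_×_; _,_; ∃)
open import Function.Base using (_∘_)
open import Function.Bundles using (_⇔_; mk⇔; Equivalence)
open import Data.Nat using (zero; suc; s≤s)
open import Data.Fin as Fin using (Fin; zero; suc)
open import Data.Fin.Properties using (<-cmp)
open import Data.Sum using (_⊎_; inj₁; inj₂)
open import Data.Empty using (⊥-elim)
open import Level using (Level)
open import Relation.Binary.Core using (Rel)
open import Relation.Binary.Definitions using (Irreflexive; Transitive; tri<; tri≈; tri>)
open import Relation.Binary.PropositionalEquality using (_≡_; refl; sym)
open import Relation.Binary.Structures using (IsStrictTotalOrder)
open import Relation.Nullary using (¬_)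

-- Defs' π ⊨ α ≻ β and π ⊨ α ≽ β are these relations on the level values C π α, C π β.
module Lexicographic {a ℓ : Level} {D : Set a} (_<_ : Rel D ℓ) where

  _≻_ : ∀ {m} → Rel (Fin m → D) (a Level.⊔ ℓ)
  x ≻ y = ∃ λ i → (y i < x i) × (∀ j → j Fin.< i → x j ≡ y j)

  _≽_ : ∀ {m} → Rel (Fin m → D) (a Level.⊔ ℓ)
  x ≽ y = (∀ i → x i ≡ y i) ⊎ x ≻ y

  pointwise⇒≽ : ∀ {m} (x y : Fin m → D) → (∀ i → (y i < x i) ⊎ (x i ≡ y i)) → x ≽ y
  pointwise⇒≽ {zero}  x y x≥y = inj₁ λ ()
  pointwise⇒≽ {suc m} x y x≥y with x≥y zero
  ... | inj₁ y₀<x₀ = inj₂ (zero , y₀<x₀ , λ _ ())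
  ... | inj₂ x₀≡y₀ with pointwise⇒≽ (x ∘ suc) (y ∘ suc) (x≥y ∘ suc)
  ... | inj₁ tail≡ = inj₁ λ { zero → x₀≡y₀ ; (suc i) → tail≡ i }
  ... | inj₂ (i , lt , prefix≡) =
    inj₂ (suc i , lt , λ { zero _ → x₀≡y₀ ; (suc j) (s≤s j<i) → prefix≡ j j<i })

  module _ (irrefl : Irreflexive _≡_ _<_) (trans : Transitive _<_) where

    ≻-asym : ∀ {m} {x y : Fin m → D} → x ≻ y → ¬ y ≻ x
    ≻-asym (i , yᵢ<xᵢ , x≡y) (j , xⱼ<yⱼ , y≡x) with <-cmp i j
    ... | tri< i<j _ _ = irrefl (y≡x i i<j) yᵢ<xᵢ
    ... | tri> _ _ j<i = irrefl (x≡y j j<i) xⱼ<yⱼ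
    ... | tri≈ _ refl _ = irrefl refl (trans yᵢ<xᵢ xⱼ<yⱼ)

    ≽⇒¬≺ : ∀ {m} (x y : Fin m → D) → x ≽ y → ¬ y ≻ x
    ≽⇒¬≺ _ _ (inj₁ x≡y) (i , xᵢ<yᵢ , _) = irrefl (x≡y i) xᵢ<yᵢ
    ≽⇒¬≺ _ _ (inj₂ x≻y) y≻x             = ≻-asym x≻y y≻x

module _ (S : Setting) where
  open Setting S
  open IsStrictTotalOrder <-isSTO using (compare; irrefl; trans)
  open Equivalence using (to; from)
  open Lexicographic _<_ using (pointwise⇒≽; ≽⇒¬≺)

  singleton : (Y : Subset n) → Nonempty Y → HModel S
  singleton Y ne = record { len = 0 ; Y = λ _ → Y ; Y-ne = λ _ → ne }

  module _ (Y : Subset n) (ne : Nonempty Y) (α β : Alt) where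
    private
      a = comb S Y ne α
      b = comb S Y ne β

    singleton-⊨≻⇔> : _⊨_≻_ S (singleton Y ne) α β ⇔ a > b
    singleton-⊨≻⇔> = mk⇔ (λ { (zero , a>b , _) → a>b }) (λ a>b → zero , a>b , λ _ ())

    singleton-⊨≽⇒≥ : _⊨_≽_ S (singleton Y ne) α β → a ≥ b
    singleton-⊨≽⇒≥ (inj₁ a≡b)              = inj₂ (a≡b zero)
    singleton-⊨≽⇒≥ (inj₂ (zero , a>b , _)) = inj₁ a>b

    ≡⇒singleton-⊨≽ : a ≡ b → _⊨_≽_ S (singleton Y ne) α β
    ≡⇒singleton-⊨≽ a≡b = inj₁ λ { zero → a≡b }

  ≮⇒≥ : ∀ {a b} → ¬ a < b → a ≥ b
  ≮⇒≥ {a} {b} a≮b with compare a b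
  ... | tri< a<b _ _ = ⊥-elim (a≮b a<b)
  ... | tri≈ _ a≡b _ = inj₂ a≡b
  ... | tri> _ _ b<a = inj₁ b<a

  ≮∧≢⇒> : ∀ {a b} → ¬ a < b → ¬ b ≡ a → a > b
  ≮∧≢⇒> a≮b b≢a with ≮⇒≥ a≮b
  ... | inj₁ a>b = a>b
  ... | inj₂ a≡b = ⊥-elim (b≢a (sym a≡b))

  module _ (α β : Alt) where

    Pointwise≥ Pointwise> : Set
    Pointwise≥ = ∀ (Y : Subset n) (ne : Nonempty Y) → comb S Y ne α ≥ comb S Y ne β
    Pointwise> = ∀ (Y : Subset n) (ne : Nonempty Y) → comb S Y ne α > comb S Y ne β

    Taut≥⇔Pointwise≥ : Taut≥ S α β ⇔ Pointwise≥
    Taut≥⇔Pointwise≥ = mk⇔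
      (λ taut Y ne → singleton-⊨≽⇒≥ Y ne α β (taut (singleton Y ne)))
      (λ pw π → pointwise⇒≽ (C S π α) (C S π β) (λ i → pw (HModel.Y π i) (HModel.Y-ne π i)))

    Taut>⇔Pointwise> : Taut> S α β ⇔ Pointwise>
    Taut>⇔Pointwise> = mk⇔
      (λ taut Y ne → to (singleton-⊨≻⇔> Y ne α β) (taut (singleton Y ne)))
      (λ pw π → zero , pw (HModel.Y π zero) (HModel.Y-ne π zero) , λ _ ())

    Contr>⇒Pointwise≥ : Contr> S β α → Pointwise≥
    Contr>⇒Pointwise≥ contr Y ne =
      ≮⇒≥ (λ a<b → contr (singleton Y ne) (from (singleton-⊨≻⇔> Y ne β α) a<b))

    Contr≥⇒Pointwise> : Contr≥ S β α → Pointwise>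
    Contr≥⇒Pointwise> contr Y ne = ≮∧≢⇒>
      (λ a<b → contr (singleton Y ne) (inj₂ (from (singleton-⊨≻⇔> Y ne β α) a<b)))
      (λ b≡a → contr (singleton Y ne) (≡⇒singleton-⊨≽ Y ne β α b≡a))

    Taut≥⇔Contr> : Taut≥ S α β ⇔ Contr> S β α
    Taut≥⇔Contr> = mk⇔
      (λ taut π → ≽⇒¬≺ irrefl trans (C S π α) (C S π β) (taut π))
      (from Taut≥⇔Pointwise≥ ∘ Contr>⇒Pointwise≥)

    Taut>⇔Contr≥ : Taut> S α β ⇔ Contr≥ S β α
    Taut>⇔Contr≥ = mk⇔
      (λ taut π β≽α → ≽⇒¬≺ irrefl trans (C S π β) (C S π α) β≽α (taut π))
      (from Taut>⇔Pointwise> ∘ Contr≥⇒Pointwise>)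

lemma7 : (S : Setting) → (α β : Setting.Alt S) →
           ((Taut≥ S α β ⇔ (∀ (Y : Subset (Setting.n S)) (ne : Nonempty Y) →
               Setting._≥_ S (comb S Y ne α) (comb S Y ne β)))
            × (Taut≥ S α β ⇔ Contr> S β α))
         × ((Taut> S α β ⇔ (∀ (Y : Subset (Setting.n S)) (ne : Nonempty Y) →
               Setting._>_ S (comb S Y ne α) (comb S Y ne β)))
            × (Taut> S α β ⇔ Contr≥ S β α))
lemma7 S α β =
  (Taut≥⇔Pointwise≥ S α β , Taut≥⇔Contr> S α β) , (Taut>⇔Pointwise> S α β , Taut>⇔Contr≥ S α β)
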